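{- For every positive integer $s$, the chain graph with binary string $0^{s}1^{2s}0^{2s}1^{s}$ is Seidel integral, i.e. all eigenvalues of its Seidel matrix are integers.
   Context: For a binary string $b=0^{s_1}1^{t_1}\cdots 0^{s_k}1^{t_k}$ with all $s_i,t_i\ge 1$ ($x^p$ denotes the symbol $x$ repeated $p$ times), the chain graph with binary string $b$ is the graph obtained by reading $b$ left to right and adding one vertex per symbol: a $0$-vertex is added with no edges, and a $1$-vertex is added adjacent to all previously added $0$-vertices and to nothing else. For a graph with adjacency matrix $A$ of order $n$, its Seidel matrix is $S=J-I-2A$, where $J$ is the all-ones matrix and $I$ the identity. -}

module Defs where

open import Data.Bool using (Bool; true; false; not; _∧_; _∨_; if_then_else_)
open import Data.Nat as ℕ using (ℕ; zero; suc; _<ᵇ_)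
open import Data.Fin using (Fin; zero; suc; toℕ; punchIn; _≟_)
open import Data.Integer using (ℤ; 0ℤ; 1ℤ; -_; _+_; _*_; _-_)
open import Data.List using (List; []; _∷_)
open import Data.Vec using (Vec; lookup; replicate; _++_; foldr)
open import Data.Product using (Σ)
open import Relation.Binary.PropositionalEquality using (_≡_)
open import Relation.Nullary.Decidable using (⌊_⌋)

-- Polynomials in one variable x over ℤ, as coefficient lists
-- (constant coefficient first).

Poly : Set
Poly = List ℤ

coeff : Poly → ℕ → ℤ
coeff []       _       = 0ℤ
coeff (a ∷ p)  zero    = a
coeff (a ∷ p)  (suc i) = coeff p i

-- equality of polynomials: all coefficients agree (trailing zeros ignored)
infix 4 _≈P_
_≈P_ : Poly → Poly → Set
p ≈P q = (i : ℕ) → coeff p i ≡ coeff q i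

infixl 6 _+P_
_+P_ : Poly → Poly → Poly
[]      +P q       = q
(a ∷ p) +P []      = a ∷ p
(a ∷ p) +P (b ∷ q) = (a + b) ∷ (p +P q)

scaleP : ℤ → Poly → Poly
scaleP c []      = []
scaleP c (a ∷ p) = (c * a) ∷ scaleP c p

negP : Poly → Poly
negP = scaleP (- 1ℤ)

infixl 7 _*P_
_*P_ : Poly → Poly → Poly
[]      *P q = []
(a ∷ p) *P q = scaleP a q +P (0ℤ ∷ (p *P q))

constP : ℤ → Poly
constP c = c ∷ []

X : Poly
X = 0ℤ ∷ 1ℤ ∷ []

Matrix : Set → ℕ → Set
Matrix A n = Fin n → Fin n → A

δ : {n : ℕ} → Fin n → Fin n → ℤ
δ i j = if ⌊ i ≟ j ⌋ then 1ℤ else 0ℤ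

altSign : ℕ → ℤ
altSign zero    = 1ℤ
altSign (suc k) = - altSign k

sumFin : {n : ℕ} → (Fin n → Poly) → Poly
sumFin {zero}  f = []
sumFin {suc n} f = f zero +P sumFin (λ j → f (suc j))

minor : {n : ℕ} → Fin (suc n) → Matrix Poly (suc n) → Matrix Poly n
minor j M r c = M (suc r) (punchIn j c)

det : {n : ℕ} → Matrix Poly n → Poly
det {zero}  M = constP 1ℤ
det {suc n} M = sumFin (λ j → constP (altSign (toℕ j)) *P (M zero j *P det (minor j M)))

charPoly : {n : ℕ} → Matrix ℤ n → Poly
charPoly M = det (λ i j → scaleP (δ i j) X +P constP (- M i j))

prodP : {n : ℕ} → Vec Poly n → Poly
prodP = foldr _ _*P_ (constP 1ℤ)

AllEigenvaluesIntegral : {n : ℕ} → Matrix ℤ n → Set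
AllEigenvaluesIntegral {n} M =
  Σ (Vec ℤ n) λ ev →
    charPoly M ≈P prodP (Data.Vec.map (λ l → X +P constP (- l)) ev)

seidel : {n : ℕ} → Matrix ℤ n → Matrix ℤ n
seidel A i j = 1ℤ - δ i j - (A i j + A i j)

-- Chain graph of a binary string b (false = symbol 0, true = symbol 1):
-- vertex i is the i-th symbol; a 1-vertex is adjacent exactly to the
-- 0-vertices that precede it.
chainAdjB : {n : ℕ} → Vec Bool n → Fin n → Fin n → Bool
chainAdjB b i j =
     ((toℕ i <ᵇ toℕ j) ∧ not (lookup b i) ∧ lookup b j)
  ∨ ((toℕ j <ᵇ toℕ i) ∧ not (lookup b j) ∧ lookup b i)

chainAdj : {n : ℕ} → Vec Bool n → Matrix ℤ n
chainAdj b i j = if chainAdjB b i j then 1ℤ else 0ℤ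

SeidelIntegral : {n : ℕ} → Matrix ℤ n → Set
SeidelIntegral A = AllEigenvaluesIntegral (seidel A)

string5 : (s : ℕ) → Vec Bool (s ℕ.+ (2 ℕ.* s ℕ.+ (2 ℕ.* s ℕ.+ s)))
string5 s = replicate s false ++ replicate (2 ℕ.* s) true
         ++ replicate (2 ℕ.* s) false ++ replicate s true

module Submission where

open import Defs
open import Data.Nat as ℕ using (ℕ; zero; suc; _<_; s≤s; z≤n)
import Data.Nat.Properties as ℕP
open import Data.Fin as Fin using (Fin; zero; suc; toℕ; punchIn; lift)
open import Data.Fin.Patterns using (0F; 1F; 2F; 3F)
import Data.Fin.Properties as FP
open import Data.Integer as ℤ using (ℤ; 0ℤ; 1ℤ; -1ℤ; -_; _+_; _*_; _-_; _^_; ∣_∣)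
import Data.Integer.Properties as ℤP
open import Data.Integer.Tactic.RingSolver using (solve-∀)
open import Data.Bool using (Bool; true; false; not; _∧_; _∨_; if_then_else_)
import Data.Bool.Properties as BP
open import Data.List using (List; []; _∷_; _++_; length; lookup; replicate)
import Data.List.Properties as LP
open import Data.Product using (_×_; _,_)
open import Data.Sum using (inj₂)
open import Data.Empty using (⊥-elim)
open import Data.Vec as Vec using (Vec)
import Data.Vec.Properties as VP
import Data.Vec.Functional as V
open import Data.Vec.Relation.Unary.All as All using (All)
import Data.Vec.Relation.Unary.All.Properties as AllP
open import Data.Vec.Relation.Unary.AllPairs as AllPairs using (AllPairs; _∷_)
open import Function using (_∘_)
open import Function.Definitions using (Injective)
open import Function.Consequences.Propositional using (inverseʳ⇒injective; strictlyInverseʳ⇒inverseʳ)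
open import Relation.Nullary using (yes; no)
open import Relation.Nullary.Decidable using (⌊⌋-map′)
import Relation.Nullary.Reflects as Reflects
open import Relation.Binary.PropositionalEquality
  using (_≡_; _≢_; _≗_; refl; sym; trans; cong; cong₂; module ≡-Reasoning)
open ≡-Reasoning
open import Algebra.Properties.Semiring.Sum ℤP.+-*-semiring
  using (sum-syntax; sum-cong-≗; sum-replicate-zero; ∑-distrib-+; *-distribˡ-sum)
open import Algebra.Properties.AbelianGroup ℤP.+-0-abelianGroup using (inverseˡ-unique)

-- Vertices in the same run of the string are twins: with y = t + 1, t I - S = y I - T where
-- T i j = τ (ℓ i) (ℓ j) only depends on the runs ℓ i and ℓ j of i and j.  Expanding along two
-- equal rows gives D (p ∷ p ∷ R) = 2y D (p ∷ R) - y² D R for D = det (y I - T), so a run of a + 1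
-- copies of a label contributes a factor y ^ a and the weight a + 1 of that label; hence D is
-- y ^ (6s - 4) times the characteristic polynomial q of the 4 × 4 quotient matrix of the runs.
-- For the runs s, 2s, 2s, s it factors as q y = y (y + 2s) (y - 4s)², so the Seidel eigenvalues are
-- -(2s + 1), 4s - 1 (twice) and -1.  Both sides of the factorisation are compared through their
-- integer values at t = 1, 2, …, which determine a polynomial.

∑-neg : ∀ {n} (f : Fin n → ℤ) → ∑[ j < n ] (- f j) ≡ - ∑[ j < n ] f j
∑-neg {n} f = begin
  ∑[ j < n ] (- f j)        ≡⟨ sum-cong-≗ (sym ∘ ℤP.-1*i≡-i ∘ f) ⟩
  ∑[ j < n ] (-1ℤ * f j)    ≡⟨ sym (*-distribˡ-sum -1ℤ f) ⟩
  -1ℤ * ∑[ j < n ] f j      ≡⟨ ℤP.-1*i≡-i _ ⟩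
  - ∑[ j < n ] f j          ∎

∑-neg-* : ∀ {n} (a b : Fin n → ℤ) → ∑[ j < n ] (- a j * b j) ≡ - ∑[ j < n ] (a j * b j)
∑-neg-* a b = trans (sum-cong-≗ λ j → sym (ℤP.neg-distribˡ-* (a j) (b j))) (∑-neg (λ j → a j * b j))

*-*-neg : ∀ a b x → a * (b * - x) ≡ - (a * (b * x))
*-*-neg = solve-∀

x≡-x⇒x≡0 : ∀ x → x ≡ - x → x ≡ 0ℤ
x≡-x⇒x≡0 x x≡-x with ℤP.i*j≡0⇒i≡0∨j≡0 (ℤ.+ 2) (trans (double x) (trans (cong (x +_) x≡-x) (ℤP.+-inverseʳ x)))
  where
  double : ∀ x → ℤ.+ 2 * x ≡ x + x
  double = solve-∀
... | inj₂ x≡0 = x≡0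

sign : {n : ℕ} → Fin n → ℤ
sign j = altSign (toℕ j)

detℤ : {n : ℕ} → Matrix ℤ n → ℤ
detℤ {zero}  M = 1ℤ
detℤ {suc n} M = ∑[ j < suc n ] (sign j * (M zero j * detℤ (λ r c → M (suc r) (punchIn j c))))

detℤ-cong : {n : ℕ} {M N : Matrix ℤ n} → (∀ i j → M i j ≡ N i j) → detℤ M ≡ detℤ N
detℤ-cong {zero}  M≗N = refl
detℤ-cong {suc n} M≗N = sum-cong-≗ λ j →
  cong₂ (λ u v → sign j * (u * v)) (M≗N zero j) (detℤ-cong (λ r c → M≗N (suc r) (punchIn j c)))

detℤ-cast : ∀ {m n} (e : m ≡ n) (M : Matrix ℤ n) → detℤ (λ i j → M (Fin.cast e i) (Fin.cast e j)) ≡ detℤ M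
detℤ-cast refl M = detℤ-cong λ i j → cong₂ M (FP.cast-is-id refl i) (FP.cast-is-id refl j)

evalP : Poly → ℤ → ℤ
evalP []      t = 0ℤ
evalP (a ∷ p) t = a + t * evalP p t
evalP-+P : ∀ p q t → evalP (p +P q) t ≡ evalP p t + evalP q t
evalP-+P []      q       t = sym (ℤP.+-identityˡ _)
evalP-+P (a ∷ p) []      t = sym (ℤP.+-identityʳ _)
evalP-+P (a ∷ p) (b ∷ q) t = begin
  (a + b) + t * evalP (p +P q) t              ≡⟨ cong (λ u → (a + b) + t * u) (evalP-+P p q t) ⟩
  (a + b) + t * (evalP p t + evalP q t)       ≡⟨ shuffle a b t _ _ ⟩
  (a + t * evalP p t) + (b + t * evalP q t)   ∎
  where
  shuffle : ∀ a b t u v → (a + b) + t * (u + v) ≡ (a + t * u) + (b + t * v)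
  shuffle = solve-∀

evalP-scaleP : ∀ c p t → evalP (scaleP c p) t ≡ c * evalP p t
evalP-scaleP c []      t = sym (ℤP.*-zeroʳ c)
evalP-scaleP c (a ∷ p) t = begin
  c * a + t * evalP (scaleP c p) t   ≡⟨ cong (λ u → c * a + t * u) (evalP-scaleP c p t) ⟩
  c * a + t * (c * evalP p t)        ≡⟨ shuffle c a t _ ⟩
  c * (a + t * evalP p t)            ∎
  where
  shuffle : ∀ c a t u → c * a + t * (c * u) ≡ c * (a + t * u)
  shuffle = solve-∀

evalP-*P : ∀ p q t → evalP (p *P q) t ≡ evalP p t * evalP q t
evalP-*P []      q t = refl
evalP-*P (a ∷ p) q t = begin
  evalP (scaleP a q +P (0ℤ ∷ p *P q)) t               ≡⟨ evalP-+P (scaleP a q) (0ℤ ∷ p *P q) t ⟩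
  evalP (scaleP a q) t + (0ℤ + t * evalP (p *P q) t)
    ≡⟨ cong₂ (λ u v → u + (0ℤ + t * v)) (evalP-scaleP a q t) (evalP-*P p q t) ⟩
  a * evalP q t + (0ℤ + t * (evalP p t * evalP q t))  ≡⟨ shuffle a t (evalP p t) (evalP q t) ⟩
  (a + t * evalP p t) * evalP q t                     ∎
  where
  shuffle : ∀ a t u v → a * v + (0ℤ + t * (u * v)) ≡ (a + t * u) * v
  shuffle = solve-∀

evalP-constP : ∀ c t → evalP (constP c) t ≡ c
evalP-constP c t = trans (cong (c +_) (ℤP.*-zeroʳ t)) (ℤP.+-identityʳ c)

evalP-X : ∀ t → evalP X t ≡ t
evalP-X = horner
  where
  horner : ∀ t → 0ℤ + t * (1ℤ + t * 0ℤ) ≡ t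
  horner = solve-∀

evalP-sumFin : ∀ {n} (f : Fin n → Poly) t → evalP (sumFin f) t ≡ ∑[ j < n ] (evalP (f j) t)
evalP-sumFin {zero}  f t = refl
evalP-sumFin {suc n} f t = trans (evalP-+P (f zero) (sumFin (f ∘ suc)) t)
                                 (cong (evalP (f zero) t +_) (evalP-sumFin (f ∘ suc) t))

evalP-det : ∀ {n} (M : Matrix Poly n) t → evalP (det M) t ≡ detℤ (λ i j → evalP (M i j) t)
evalP-det {zero}  M t = evalP-constP 1ℤ t
evalP-det {suc n} M t =
  trans (evalP-sumFin (λ j → constP (sign j) *P (M zero j *P det (minor j M))) t) (sum-cong-≗ λ j → begin
  evalP (constP (sign j) *P (M zero j *P det (minor j M))) t
    ≡⟨ evalP-*P (constP (sign j)) (M zero j *P det (minor j M)) t ⟩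
  evalP (constP (sign j)) t * evalP (M zero j *P det (minor j M)) t
    ≡⟨ cong₂ _*_ (evalP-constP (sign j) t) (evalP-*P (M zero j) (det (minor j M)) t) ⟩
  sign j * (evalP (M zero j) t * evalP (det (minor j M)) t)
    ≡⟨ cong (λ u → sign j * (evalP (M zero j) t * u)) (evalP-det (minor j M) t) ⟩
  sign j * (evalP (M zero j) t * detℤ (λ r c → evalP (M (suc r) (punchIn j c)) t)) ∎)

evalP-charPoly : ∀ {n} (M : Matrix ℤ n) t → evalP (charPoly M) t ≡ detℤ (λ i j → t * δ i j - M i j)
evalP-charPoly M t =
  trans (evalP-det (λ i j → scaleP (δ i j) X +P constP (- M i j)) t) (detℤ-cong λ i j → begin
  evalP (scaleP (δ i j) X +P constP (- M i j)) t            ≡⟨ evalP-+P (scaleP (δ i j) X) (constP (- M i j)) t ⟩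
  evalP (scaleP (δ i j) X) t + evalP (constP (- M i j)) t   ≡⟨ cong₂ _+_ (evalP-scaleP (δ i j) X t) (evalP-constP (- M i j) t) ⟩
  δ i j * evalP X t - M i j                                 ≡⟨ cong (λ u → δ i j * u - M i j) (evalP-X t) ⟩
  δ i j * t - M i j                                         ≡⟨ cong (_- M i j) (ℤP.*-comm (δ i j) t) ⟩
  t * δ i j - M i j                                         ∎)

linearProduct : ∀ {n} → ℤ → Vec ℤ n → ℤ
linearProduct t = Vec.foldr _ (λ l r → (t - l) * r) 1ℤ

evalP-linearFactors : ∀ {n} (v : Vec ℤ n) t →
  evalP (prodP (Vec.map (λ l → X +P constP (- l)) v)) t ≡ linearProduct t v
evalP-linearFactors Vec.[]      t = evalP-constP 1ℤ t
evalP-linearFactors (l Vec.∷ v) t = begin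
  evalP ((X +P constP (- l)) *P prodP (Vec.map (λ l → X +P constP (- l)) v)) t
    ≡⟨ evalP-*P (X +P constP (- l)) (prodP (Vec.map (λ l → X +P constP (- l)) v)) t ⟩
  evalP (X +P constP (- l)) t * evalP (prodP (Vec.map (λ l → X +P constP (- l)) v)) t
    ≡⟨ cong₂ _*_ (trans (evalP-+P X (constP (- l)) t) (cong₂ _+_ (evalP-X t) (evalP-constP (- l) t)))
                 (evalP-linearFactors v t) ⟩
  (t - l) * linearProduct t v ∎

-- A polynomial is determined by its values at the positive integers

coeff-+P : ∀ p q i → coeff (p +P q) i ≡ coeff p i + coeff q i
coeff-+P []      q       i       = sym (ℤP.+-identityˡ _)
coeff-+P (a ∷ p) []      i       = sym (ℤP.+-identityʳ _)
coeff-+P (a ∷ p) (b ∷ q) zero    = refl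
coeff-+P (a ∷ p) (b ∷ q) (suc i) = coeff-+P p q i

coeff-scaleP : ∀ c p i → coeff (scaleP c p) i ≡ c * coeff p i
coeff-scaleP c []      i       = sym (ℤP.*-zeroʳ c)
coeff-scaleP c (a ∷ p) zero    = refl
coeff-scaleP c (a ∷ p) (suc i) = coeff-scaleP c p i

n≡[1+n]*m⇒m≡0 : ∀ n m → n ≡ suc n ℕ.* m → m ≡ 0
n≡[1+n]*m⇒m≡0 n zero    _ = refl
n≡[1+n]*m⇒m≡0 n (suc m) e = ⊥-elim (ℕP.<⇒≢ (ℕP.≤-trans (ℕP.n<1+n n) (ℕP.m≤m*n (suc n) (suc m))) e)

-- At t = ∣ a ∣ + 1 the equation reads ∣ a ∣ = t ∣ f t ∣, which forces f t = 0 and then a = 0.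
constantTerm≡0 : ∀ a (f : ℕ → ℤ) → (∀ k → a + ℤ.+ suc k * f k ≡ 0ℤ) → a ≡ 0ℤ
constantTerm≡0 a f vanish = ℤP.∣i∣≡0⇒i≡0 ∣a∣≡0
  where
  n : ℕ
  n = ∣ a ∣
  ∣a∣≡[1+∣a∣]*∣f∣ : n ≡ suc n ℕ.* ∣ f n ∣
  ∣a∣≡[1+∣a∣]*∣f∣ = begin
    ∣ a ∣                        ≡⟨ cong ∣_∣ (inverseˡ-unique a _ (vanish n)) ⟩
    ∣ - (ℤ.+ suc n * f n) ∣      ≡⟨ ℤP.∣-i∣≡∣i∣ (ℤ.+ suc n * f n) ⟩
    ∣ ℤ.+ suc n * f n ∣          ≡⟨ ℤP.abs-* (ℤ.+ suc n) (f n) ⟩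
    suc n ℕ.* ∣ f n ∣            ∎
  ∣a∣≡0 : n ≡ 0
  ∣a∣≡0 = trans ∣a∣≡[1+∣a∣]*∣f∣
    (trans (cong (suc n ℕ.*_) (n≡[1+n]*m⇒m≡0 n ∣ f n ∣ ∣a∣≡[1+∣a∣]*∣f∣)) (ℕP.*-zeroʳ (suc n)))

evalP-vanishing⇒coeff≡0 : ∀ p → (∀ k → evalP p (ℤ.+ suc k) ≡ 0ℤ) → ∀ i → coeff p i ≡ 0ℤ
evalP-vanishing⇒coeff≡0 []      _      _ = refl
evalP-vanishing⇒coeff≡0 (a ∷ p) vanish i = coeff≡0 i
  where
  a≡0 : a ≡ 0ℤ
  a≡0 = constantTerm≡0 a (evalP p ∘ ℤ.+_ ∘ suc) vanish
  p-vanish : ∀ k → evalP p (ℤ.+ suc k) ≡ 0ℤ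
  p-vanish k with ℤP.i*j≡0⇒i≡0∨j≡0 (ℤ.+ suc k)
                    (trans (sym (ℤP.+-identityˡ _)) (trans (cong (λ c → c + _) (sym a≡0)) (vanish k)))
  ... | inj₂ p≡0 = p≡0
  coeff≡0 : ∀ i → coeff (a ∷ p) i ≡ 0ℤ
  coeff≡0 zero    = a≡0
  coeff≡0 (suc i) = evalP-vanishing⇒coeff≡0 p p-vanish i

≈P-fromEval : ∀ p q → (∀ k → evalP p (ℤ.+ suc k) ≡ evalP q (ℤ.+ suc k)) → p ≈P q
≈P-fromEval p q agree i = begin
  coeff p i                                   ≡⟨ rearrange (coeff p i) (coeff q i) ⟩
  (coeff p i + -1ℤ * coeff q i) + coeff q i   ≡⟨ cong (_+ coeff q i) difference≡0 ⟩
  0ℤ + coeff q i                              ≡⟨ ℤP.+-identityˡ (coeff q i) ⟩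
  coeff q i                                   ∎
  where
  rearrange : ∀ x y → x ≡ (x + -1ℤ * y) + y
  rearrange = solve-∀
  cancel : ∀ x → x + -1ℤ * x ≡ 0ℤ
  cancel = solve-∀
  difference≡0 : coeff p i + -1ℤ * coeff q i ≡ 0ℤ
  difference≡0 = begin
    coeff p i + -1ℤ * coeff q i   ≡⟨ cong (coeff p i +_) (sym (coeff-scaleP -1ℤ q i)) ⟩
    coeff p i + coeff (negP q) i  ≡⟨ sym (coeff-+P p (negP q) i) ⟩
    coeff (p +P negP q) i         ≡⟨ evalP-vanishing⇒coeff≡0 (p +P negP q) (λ k → begin
      evalP (p +P negP q) (ℤ.+ suc k)                         ≡⟨ evalP-+P p (negP q) (ℤ.+ suc k) ⟩
      evalP p (ℤ.+ suc k) + evalP (negP q) (ℤ.+ suc k)        ≡⟨ cong₂ _+_ (agree k) (evalP-scaleP -1ℤ q (ℤ.+ suc k)) ⟩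
      evalP q (ℤ.+ suc k) + -1ℤ * evalP q (ℤ.+ suc k)         ≡⟨ cancel (evalP q (ℤ.+ suc k)) ⟩
      0ℤ                                                       ∎) i ⟩
    0ℤ                            ∎

-- Alternation of the Laplace determinant

swap₀ : {n : ℕ} → Fin n → Fin n
swap₀ {suc (suc n)} 0F            = 1F
swap₀ {suc (suc n)} 1F            = 0F
swap₀ {suc (suc n)} (suc (suc i)) = suc (suc i)
swap₀ {suc zero}    0F            = 0F

-- The transposition of k and k + 1; the identity when k + 1 is out of range.
swapAt : {n : ℕ} → ℕ → Fin n → Fin n
swapAt zero    i       = swap₀ i
swapAt (suc k) zero    = zero
swapAt (suc k) (suc i) = suc (swapAt k i)

swapAt-involutive : ∀ {n} k (i : Fin n) → swapAt k (swapAt k i) ≡ i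
swapAt-involutive {suc (suc n)} zero 0F            = refl
swapAt-involutive {suc (suc n)} zero 1F            = refl
swapAt-involutive {suc (suc n)} zero (suc (suc i)) = refl
swapAt-involutive {suc zero}    zero 0F            = refl
swapAt-involutive (suc k) zero    = refl
swapAt-involutive (suc k) (suc i) = cong suc (swapAt-involutive k i)

swapAt-injective : ∀ {n} k → Injective _≡_ _≡_ (swapAt {n} k)
swapAt-injective k =
  inverseʳ⇒injective (swapAt k) (strictlyInverseʳ⇒inverseʳ {f⁻¹ = swapAt k} (swapAt k) (swapAt-involutive k))

cast-injective : ∀ {m n} (e : m ≡ n) → Injective _≡_ _≡_ (Fin.cast e)
cast-injective e =
  inverseʳ⇒injective (Fin.cast e) (strictlyInverseʳ⇒inverseʳ {f⁻¹ = Fin.cast (sym e)} (Fin.cast e) (FP.cast-involutive (sym e) e))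

laplace : {n : ℕ} → (Fin (suc n) → ℤ) → ((Fin n → Fin (suc n)) → ℤ) → ℤ
laplace {n} u Ψ = ∑[ j < suc n ] (sign j * (u j * Ψ (punchIn j)))

columnsDet : {m n : ℕ} → (Fin m → Fin n → ℤ) → (Fin m → Fin n) → ℤ
columnsDet R g = detℤ (λ r c → R r (g c))

Extensional : {m n : ℕ} → ((Fin m → Fin n) → ℤ) → Set
Extensional Ψ = ∀ {g h} → g ≗ h → Ψ g ≡ Ψ h

Alternating : {m n : ℕ} → ((Fin m → Fin n) → ℤ) → Set
Alternating {m} Ψ = ∀ k → suc (suc k) ℕ.≤ m → ∀ g → Ψ (g ∘ swapAt k) ≡ - Ψ g

columnsDet-extensional : {m n : ℕ} (R : Fin m → Fin n → ℤ) → Extensional (columnsDet R)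
columnsDet-extensional R g≗h = detℤ-cong λ r c → cong (R r) (g≗h c)

laplace-cong : ∀ {n} {u v : Fin (suc n) → ℤ} {Ψ Φ : (Fin n → Fin (suc n)) → ℤ} →
  u ≗ v → (∀ j → Ψ (punchIn j) ≡ Φ (punchIn j)) → laplace u Ψ ≡ laplace v Φ
laplace-cong u≗v Ψ≗Φ = sum-cong-≗ λ j → cong₂ (λ a b → sign j * (a * b)) (u≗v j) (Ψ≗Φ j)

private
  lift₁ : {m n : ℕ} → (Fin m → Fin n) → Fin (suc m) → Fin (suc n)
  lift₁ = lift 1

  lift₁-cong : {m n : ℕ} {g h : Fin m → Fin n} → g ≗ h → lift₁ g ≗ lift₁ h
  lift₁-cong g≗h zero    = refl
  lift₁-cong g≗h (suc c) = cong suc (g≗h c)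

  Ψ⁺ : {m n : ℕ} → ((Fin (suc m) → Fin (suc n)) → ℤ) → (Fin m → Fin n) → ℤ
  Ψ⁺ Ψ g = Ψ (lift₁ g)

  Ψ⁺-extensional : {m n : ℕ} {Ψ : (Fin (suc m) → Fin (suc n)) → ℤ} → Extensional Ψ → Extensional (Ψ⁺ Ψ)
  Ψ⁺-extensional ext g≗h = ext (lift₁-cong g≗h)

  Ψ⁺-alternating : {m n : ℕ} {Ψ : (Fin (suc m) → Fin (suc n)) → ℤ} →
    Extensional Ψ → Alternating Ψ → Alternating (Ψ⁺ Ψ)
  Ψ⁺-alternating ext alt k k+2≤m g = trans (ext lift-swap) (alt (suc k) (s≤s k+2≤m) (lift₁ g))
    where
    lift-swap : lift₁ (g ∘ swapAt k) ≗ lift₁ g ∘ swapAt (suc k)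
    lift-swap zero    = refl
    lift-swap (suc c) = refl

  swap₀-punchIn : ∀ {m} (j : Fin m) → swap₀ ∘ punchIn (suc (suc j)) ≗ punchIn (suc (suc j)) ∘ swap₀
  swap₀-punchIn {suc m} j 0F            = refl
  swap₀-punchIn {suc m} j 1F            = refl
  swap₀-punchIn {suc m} j (suc (suc c)) = refl

  2≤1+size : ∀ {m} → Fin m → 2 ℕ.≤ suc m
  2≤1+size {suc m} _ = s≤s (s≤s z≤n)

-- Terms 0 and 1 of the expansion trade places; the others change sign by alternation of Ψ.
laplace-swap₀Columns : ∀ {m} (u : Fin (suc (suc m)) → ℤ) {Ψ : (Fin (suc m) → Fin (suc (suc m))) → ℤ} →
  Extensional Ψ → Alternating Ψ → laplace (u ∘ swap₀) (Ψ ∘ (swap₀ ∘_)) ≡ - laplace u Ψ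
laplace-swap₀Columns {m} u {Ψ} ext alt = begin
  1ℤ * (u 1F * Ψ (swap₀ ∘ suc)) + (-1ℤ * (u 0F * Ψ (swap₀ ∘ punchIn 1F)) + rest)
    ≡⟨ cong₂ (λ a b → 1ℤ * (u 1F * a) + (-1ℤ * (u 0F * b) + rest)) (ext swap₀-suc) (ext swap₀-punchIn₁) ⟩
  1ℤ * (u 1F * Ψ (punchIn 1F)) + (-1ℤ * (u 0F * Ψ suc) + rest)
    ≡⟨ cong (λ r → 1ℤ * (u 1F * Ψ (punchIn 1F)) + (-1ℤ * (u 0F * Ψ suc) + r)) rest≡-rest′ ⟩
  1ℤ * (u 1F * Ψ (punchIn 1F)) + (-1ℤ * (u 0F * Ψ suc) + - rest′)
    ≡⟨ rearrange (u 0F) (u 1F) (Ψ suc) (Ψ (punchIn 1F)) rest′ ⟩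
  - laplace u Ψ ∎
  where
  term : Fin m → (Fin (suc m) → Fin (suc (suc m))) → ℤ
  term j g = sign (suc (suc j)) * (u (suc (suc j)) * Ψ g)
  rest rest′ : ℤ
  rest  = ∑[ j < m ] (term j (swap₀ ∘ punchIn (suc (suc j))))
  rest′ = ∑[ j < m ] (term j (punchIn (suc (suc j))))
  swap₀-suc : swap₀ ∘ suc ≗ punchIn 1F
  swap₀-suc zero    = refl
  swap₀-suc (suc c) = refl
  swap₀-punchIn₁ : swap₀ ∘ punchIn 1F ≗ suc
  swap₀-punchIn₁ zero    = refl
  swap₀-punchIn₁ (suc c) = refl
  rest≡-rest′ : rest ≡ - rest′
  rest≡-rest′ = trans (sum-cong-≗ λ j →
    trans (cong (λ x → sign (suc (suc j)) * (u (suc (suc j)) * x))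
                (trans (ext (swap₀-punchIn j)) (alt zero (2≤1+size j) (punchIn (suc (suc j))))))
          (*-*-neg (sign (suc (suc j))) (u (suc (suc j))) (Ψ (punchIn (suc (suc j))))))
    (∑-neg (λ j → term j (punchIn (suc (suc j)))))
  rearrange : ∀ u₀ u₁ a b r → 1ℤ * (u₁ * b) + (-1ℤ * (u₀ * a) + - r) ≡ - (1ℤ * (u₀ * a) + (-1ℤ * (u₁ * b) + r))
  rearrange = solve-∀

-- For k > 0 the transposition fixes column 0 and the claim is the same one for the lower columns.
laplace-swapColumns : ∀ {n} (u : Fin (suc n) → ℤ) {Ψ : (Fin n → Fin (suc n)) → ℤ} →
  Extensional Ψ → Alternating Ψ → ∀ k → suc (suc k) ℕ.≤ suc n →
  laplace (u ∘ swapAt k) (Ψ ∘ (swapAt k ∘_)) ≡ - laplace u Ψ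
laplace-swapColumns {zero}  u ext alt zero    (s≤s ())
laplace-swapColumns {suc m} u ext alt zero    _ = laplace-swap₀Columns u ext alt
laplace-swapColumns {suc m} u {Ψ} ext alt (suc k) (s≤s k+2≤1+m) = begin
  1ℤ * (u 0F * Ψ (suc ∘ swapAt k)) + ∑[ j < suc m ] (- sign j * (u (suc (swapAt k j)) * Ψ (swapAt (suc k) ∘ punchIn (suc j))))
    ≡⟨ cong₂ (λ a b → 1ℤ * (u 0F * a) + b) (alt k k+2≤1+m suc)
             (∑-neg-* sign λ j → u (suc (swapAt k j)) * Ψ (swapAt (suc k) ∘ punchIn (suc j))) ⟩
  1ℤ * (u 0F * - Ψ suc) + - ∑[ j < suc m ] (sign j * (u (suc (swapAt k j)) * Ψ (swapAt (suc k) ∘ punchIn (suc j))))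
    ≡⟨ cong (λ r → 1ℤ * (u 0F * - Ψ suc) + - r) (begin
        ∑[ j < suc m ] (sign j * (u (suc (swapAt k j)) * Ψ (swapAt (suc k) ∘ punchIn (suc j))))
          ≡⟨ sum-cong-≗ (λ j → cong (λ x → sign j * (u (suc (swapAt k j)) * x)) (ext (lift-swap j))) ⟩
        laplace (u ∘ suc ∘ swapAt k) (Ψ⁺ Ψ ∘ (swapAt k ∘_))
          ≡⟨ laplace-swapColumns (u ∘ suc) (Ψ⁺-extensional ext) (Ψ⁺-alternating ext alt) k k+2≤1+m ⟩
        - laplace (u ∘ suc) (Ψ⁺ Ψ)
          ≡⟨ cong -_ (sum-cong-≗ λ j → cong (λ x → sign j * (u (suc j) * x)) (ext (lift-punchIn j))) ⟩
        - ∑[ j < suc m ] (sign j * (u (suc j) * Ψ (punchIn (suc j)))) ∎) ⟩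
  1ℤ * (u 0F * - Ψ suc) + - - ∑[ j < suc m ] (sign j * (u (suc j) * Ψ (punchIn (suc j))))
    ≡⟨ cong (λ r → 1ℤ * (u 0F * - Ψ suc) + - r) (sym (∑-neg-* sign λ j → u (suc j) * Ψ (punchIn (suc j)))) ⟩
  1ℤ * (u 0F * - Ψ suc) + - ∑[ j < suc m ] (- sign j * (u (suc j) * Ψ (punchIn (suc j))))
    ≡⟨ rearrange (u 0F) (Ψ suc) _ ⟩
  - laplace u Ψ ∎
  where
  lift-swap : ∀ j → swapAt (suc k) ∘ punchIn (suc j) ≗ lift₁ (swapAt k ∘ punchIn j)
  lift-swap j zero    = refl
  lift-swap j (suc c) = refl
  lift-punchIn : ∀ j → lift₁ (punchIn j) ≗ punchIn (suc j)
  lift-punchIn j zero    = refl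
  lift-punchIn j (suc c) = refl
  rearrange : ∀ a x r → 1ℤ * (a * - x) + - r ≡ - (1ℤ * (a * x) + r)
  rearrange = solve-∀

columnsDet-alternating : {m n : ℕ} (R : Fin m → Fin n → ℤ) → Alternating (columnsDet R)
detℤ-swapColumns : ∀ {n} k → suc (suc k) ℕ.≤ n → (M : Matrix ℤ n) → detℤ (λ i j → M i (swapAt k j)) ≡ - detℤ M

columnsDet-alternating R k k+2≤m g = detℤ-swapColumns k k+2≤m (λ r c → R r (g c))
detℤ-swapColumns {suc n} k k+2≤n M =
  laplace-swapColumns (M zero) (columnsDet-extensional (M ∘ suc)) (columnsDet-alternating (M ∘ suc)) k k+2≤n

laplace₂ : {n : ℕ} → (a b : Fin (suc (suc n)) → ℤ) → ((Fin n → Fin (suc (suc n))) → ℤ) → ℤ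
laplace₂ a b Φ = laplace a (λ g → laplace (b ∘ g) (λ h → Φ (g ∘ h)))

private
  edge : {n : ℕ} → (Fin (suc (suc n)) → ℤ) → ((Fin n → Fin (suc (suc n))) → ℤ) → ℤ
  edge a Φ = laplace (a ∘ suc) (λ h → Φ (suc ∘ h))

  inner : {n : ℕ} → (Fin (suc (suc n)) → ℤ) → ((Fin n → Fin (suc (suc n))) → ℤ) → Fin (suc n) → ℤ
  inner b Φ j = ∑[ k < _ ] (sign k * (b (suc (punchIn j k)) * Φ (punchIn (suc j) ∘ punchIn (suc k))))

  tail₂ : {n : ℕ} → (a b : Fin (suc (suc n)) → ℤ) → ((Fin n → Fin (suc (suc n))) → ℤ) → ℤ
  tail₂ {n} a b Φ = ∑[ j < suc n ] (sign j * (a (suc j) * inner b Φ j))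

-- Separate the terms using column 0 in one of the two rows.
laplace₂-peel : ∀ {n} (a b : Fin (suc (suc n)) → ℤ) Φ →
  laplace₂ a b Φ ≡ a 0F * edge b Φ + (- (b 0F * edge a Φ) + tail₂ a b Φ)
laplace₂-peel {n} a b Φ = begin
  1ℤ * (a 0F * edge b Φ)
    + ∑[ j < suc n ] (- sign j * (a (suc j) * ∑[ k < suc n ] (sign k * (b (punchIn (suc j) k) * Φ (punchIn (suc j) ∘ punchIn k)))))
    ≡⟨ cong (1ℤ * (a 0F * edge b Φ) +_) (sum-cong-≗ λ j →
         cong (λ x → - sign j * (a (suc j) * (1ℤ * (b 0F * Φ (suc ∘ punchIn j)) + x)))
              (∑-neg-* sign λ k → b (suc (punchIn j k)) * Φ (punchIn (suc j) ∘ punchIn (suc k)))) ⟩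
  1ℤ * (a 0F * edge b Φ) + ∑[ j < suc n ] (- sign j * (a (suc j) * (1ℤ * (b 0F * Φ (suc ∘ punchIn j)) + - inner b Φ j)))
    ≡⟨ cong (1ℤ * (a 0F * edge b Φ) +_) (sum-cong-≗ λ j →
         expand (sign j) (a (suc j)) (b 0F) (Φ (suc ∘ punchIn j)) (inner b Φ j)) ⟩
  1ℤ * (a 0F * edge b Φ)
    + ∑[ j < suc n ] (- (b 0F * (sign j * (a (suc j) * Φ (suc ∘ punchIn j)))) + sign j * (a (suc j) * inner b Φ j))
    ≡⟨ cong (1ℤ * (a 0F * edge b Φ) +_) (trans
         (∑-distrib-+ (λ j → - (b 0F * (sign j * (a (suc j) * Φ (suc ∘ punchIn j)))))
                      (λ j → sign j * (a (suc j) * inner b Φ j)))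
         (cong (_+ tail₂ a b Φ) (trans (∑-neg λ j → b 0F * (sign j * (a (suc j) * Φ (suc ∘ punchIn j))))
                                       (cong -_ (sym (*-distribˡ-sum (b 0F) λ j → sign j * (a (suc j) * Φ (suc ∘ punchIn j)))))))) ⟩
  1ℤ * (a 0F * edge b Φ) + (- (b 0F * edge a Φ) + tail₂ a b Φ)
    ≡⟨ cong (_+ (- (b 0F * edge a Φ) + tail₂ a b Φ)) (ℤP.*-identityˡ (a 0F * edge b Φ)) ⟩
  a 0F * edge b Φ + (- (b 0F * edge a Φ) + tail₂ a b Φ) ∎
  where
  expand : ∀ s a b₀ x w → - s * (a * (1ℤ * (b₀ * x) + - w)) ≡ - (b₀ * (s * (a * x))) + s * (a * w)
  expand = solve-∀

laplace₂-antisym : ∀ {n} (a b : Fin (suc (suc n)) → ℤ) {Φ : (Fin n → Fin (suc (suc n))) → ℤ} →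
  Extensional Φ → laplace₂ a b Φ + laplace₂ b a Φ ≡ 0ℤ
tail₂-antisym : ∀ {n} (a b : Fin (suc (suc n)) → ℤ) {Φ : (Fin n → Fin (suc (suc n))) → ℤ} →
  Extensional Φ → tail₂ a b Φ + tail₂ b a Φ ≡ 0ℤ

laplace₂-antisym a b {Φ} ext = begin
  laplace₂ a b Φ + laplace₂ b a Φ
    ≡⟨ cong₂ _+_ (laplace₂-peel a b Φ) (laplace₂-peel b a Φ) ⟩
  (a 0F * edge b Φ + (- (b 0F * edge a Φ) + tail₂ a b Φ)) + (b 0F * edge a Φ + (- (a 0F * edge b Φ) + tail₂ b a Φ))
    ≡⟨ cancel (a 0F * edge b Φ) (b 0F * edge a Φ) (tail₂ a b Φ) (tail₂ b a Φ) ⟩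
  tail₂ a b Φ + tail₂ b a Φ
    ≡⟨ tail₂-antisym a b ext ⟩
  0ℤ ∎
  where
  cancel : ∀ x y s t → (x + (- y + s)) + (y + (- x + t)) ≡ s + t
  cancel = solve-∀

tail₂-antisym {zero} a b ext = vanish (a 1F) (b 1F)
  where
  vanish : ∀ x y → (1ℤ * (x * 0ℤ) + 0ℤ) + (1ℤ * (y * 0ℤ) + 0ℤ) ≡ 0ℤ
  vanish = solve-∀
tail₂-antisym {suc m} a b {Φ} ext = begin
  tail₂ a b Φ + tail₂ b a Φ
    ≡⟨ cong₂ _+_ (shift a b) (shift b a) ⟩
  laplace₂ (a ∘ suc) (b ∘ suc) (Ψ⁺ Φ) + laplace₂ (b ∘ suc) (a ∘ suc) (Ψ⁺ Φ)
    ≡⟨ laplace₂-antisym (a ∘ suc) (b ∘ suc) (Ψ⁺-extensional ext) ⟩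
  0ℤ ∎
  where
  lift-punchIn₂ : ∀ j k → punchIn (suc j) ∘ punchIn (suc k) ≗ lift₁ (punchIn j ∘ punchIn k)
  lift-punchIn₂ j k zero    = refl
  lift-punchIn₂ j k (suc c) = refl
  shift : ∀ a b → tail₂ a b Φ ≡ laplace₂ (a ∘ suc) (b ∘ suc) (Ψ⁺ Φ)
  shift a b = sum-cong-≗ λ j → cong (λ x → sign j * (a (suc j) * x)) (sum-cong-≗ λ k →
    cong (λ x → sign k * (b (suc (punchIn j k)) * x)) (ext (lift-punchIn₂ j k)))

detℤ-swapRows : ∀ {n} k → suc (suc k) ℕ.≤ n → (M : Matrix ℤ n) → detℤ (λ i j → M (swapAt k i) j) ≡ - detℤ M
detℤ-swapRows {suc (suc n)} zero _ M =
  inverseˡ-unique _ _ (laplace₂-antisym (M 1F) (M 0F) (columnsDet-extensional (λ r → M (suc (suc r)))))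
detℤ-swapRows {suc n} (suc k) (s≤s k+2≤n) M = trans
  (sum-cong-≗ λ j → trans (cong (λ x → sign j * (M zero j * x)) (detℤ-swapRows k k+2≤n (λ r c → M (suc r) (punchIn j c))))
                          (*-*-neg (sign j) (M zero j) (detℤ (λ r c → M (suc r) (punchIn j c)))))
  (∑-neg λ j → sign j * (M zero j * detℤ (λ r c → M (suc r) (punchIn j c))))

detℤ-swap : ∀ {n} k → suc (suc k) ℕ.≤ n → (M : Matrix ℤ n) → detℤ (λ i j → M (swapAt k i) (swapAt k j)) ≡ detℤ M
detℤ-swap k k+2≤n M = begin
  detℤ (λ i j → M (swapAt k i) (swapAt k j))  ≡⟨ detℤ-swapRows k k+2≤n (λ i j → M i (swapAt k j)) ⟩
  - detℤ (λ i j → M i (swapAt k j))            ≡⟨ cong -_ (detℤ-swapColumns k k+2≤n M) ⟩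
  - - detℤ M                                    ≡⟨ ℤP.neg-involutive (detℤ M) ⟩
  detℤ M                                        ∎

detℤ-equalRows : ∀ {n} (M : Matrix ℤ (suc (suc n))) → M 0F ≗ M 1F → detℤ M ≡ 0ℤ
detℤ-equalRows M rows≡ = x≡-x⇒x≡0 (detℤ M) (trans (sym (detℤ-cong swapped≗)) (detℤ-swapRows zero (s≤s (s≤s z≤n)) M))
  where
  swapped≗ : ∀ i j → M (swapAt zero i) j ≡ M i j
  swapped≗ 0F            j = sym (rows≡ j)
  swapped≗ 1F            j = rows≡ j
  swapped≗ (suc (suc i)) j = refl

δ-suc : ∀ {n} (i j : Fin n) → δ (suc i) (suc j) ≡ δ i j
δ-suc i j = cong (λ b → if b then 1ℤ else 0ℤ) (⌊⌋-map′ (cong suc) FP.suc-injective (i FP.≟ j))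

δ-refl : ∀ {n} (i : Fin n) → δ i i ≡ 1ℤ
δ-refl i with i FP.≟ i
... | yes _  = refl
... | no i≢i = ⊥-elim (i≢i refl)

δ-≢ : ∀ {n} {i j : Fin n} → i ≢ j → δ i j ≡ 0ℤ
δ-≢ {i = i} {j} i≢j with i FP.≟ j
... | yes i≡j = ⊥-elim (i≢j i≡j)
... | no _    = refl

δ-injective : ∀ {m n} (f : Fin m → Fin n) → Injective _≡_ _≡_ f → ∀ i j → δ (f i) (f j) ≡ δ i j
δ-injective f inj i j with i FP.≟ j
... | yes refl = δ-refl (f i)
... | no i≢j   = δ-≢ (i≢j ∘ inj)

∑-δ : ∀ {n} (f : Fin n → ℤ) i → ∑[ j < n ] (f j * δ i j) ≡ f i
∑-δ {suc n} f zero = begin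
  f 0F * 1ℤ + ∑[ j < n ] (f (suc j) * 0ℤ)
    ≡⟨ cong₂ _+_ (ℤP.*-identityʳ (f 0F)) (trans (sum-cong-≗ (ℤP.*-zeroʳ ∘ f ∘ suc)) (sum-replicate-zero n)) ⟩
  f 0F + 0ℤ
    ≡⟨ ℤP.+-identityʳ (f 0F) ⟩
  f 0F ∎
∑-δ {suc n} f (suc i) = begin
  f 0F * 0ℤ + ∑[ j < n ] (f (suc j) * δ (suc i) (suc j))
    ≡⟨ cong₂ _+_ (ℤP.*-zeroʳ (f 0F)) (sum-cong-≗ λ j → cong (f (suc j) *_) (δ-suc i j)) ⟩
  0ℤ + ∑[ j < n ] (f (suc j) * δ i j)
    ≡⟨ ℤP.+-identityˡ _ ⟩
  ∑[ j < n ] (f (suc j) * δ i j)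
    ≡⟨ ∑-δ (f ∘ suc) i ⟩
  f (suc i) ∎

laplace-+δ : ∀ {n} (u : Fin (suc n) → ℤ) (Ψ : (Fin n → Fin (suc n)) → ℤ) c i →
  laplace (λ j → u j + c * δ i j) Ψ ≡ laplace u Ψ + sign i * (c * Ψ (punchIn i))
laplace-+δ {n} u Ψ c i = begin
  ∑[ j < suc n ] (sign j * ((u j + c * δ i j) * Ψ (punchIn j)))
    ≡⟨ sum-cong-≗ (λ j → distribute (sign j) (u j) c (δ i j) (Ψ (punchIn j))) ⟩
  ∑[ j < suc n ] (sign j * (u j * Ψ (punchIn j)) + sign j * (c * Ψ (punchIn j)) * δ i j)
    ≡⟨ ∑-distrib-+ (λ j → sign j * (u j * Ψ (punchIn j))) (λ j → sign j * (c * Ψ (punchIn j)) * δ i j) ⟩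
  laplace u Ψ + ∑[ j < suc n ] (sign j * (c * Ψ (punchIn j)) * δ i j)
    ≡⟨ cong (laplace u Ψ +_) (∑-δ (λ j → sign j * (c * Ψ (punchIn j))) i) ⟩
  laplace u Ψ + sign i * (c * Ψ (punchIn i)) ∎
  where
  distribute : ∀ s a c d x → s * ((a + c * d) * x) ≡ s * (a * x) + s * (c * x) * d
  distribute = solve-∀

-- Runs of equal labels

blockStep : ℤ → ℕ → ℤ → ℤ → ℤ
blockStep y a e₁ e₀ = (1ℤ + ℤ.+ a) * e₁ - ℤ.+ a * (y * e₀)

doubleRoot-recurrence : ∀ y (e : ℕ → ℤ) → (∀ k → e (suc (suc k)) ≡ ℤ.+ 2 * y * e (suc k) - y * y * e k) →
  ∀ a → e (suc a) ≡ y ^ a * blockStep y a (e 1) (e 0)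
doubleRoot-recurrence y e rec zero          = base₀ y (e 1) (e 0)
  where
  base₀ : ∀ y e₁ e₀ → e₁ ≡ 1ℤ * ((1ℤ + 0ℤ) * e₁ - 0ℤ * (y * e₀))
  base₀ = solve-∀
doubleRoot-recurrence y e rec (suc zero)    = trans (rec 0) (base₁ y (e 1) (e 0))
  where
  base₁ : ∀ y e₁ e₀ → ℤ.+ 2 * y * e₁ - y * y * e₀ ≡ y * 1ℤ * ((1ℤ + 1ℤ) * e₁ - 1ℤ * (y * e₀))
  base₁ = solve-∀
doubleRoot-recurrence y e rec (suc (suc a)) = begin
  e (suc (suc (suc a)))
    ≡⟨ rec (suc a) ⟩
  ℤ.+ 2 * y * e (suc (suc a)) - y * y * e (suc a)
    ≡⟨ cong₂ (λ u v → ℤ.+ 2 * y * u - y * y * v) (doubleRoot-recurrence y e rec (suc a)) (doubleRoot-recurrence y e rec a) ⟩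
  ℤ.+ 2 * y * (y ^ suc a * blockStep y (suc a) (e 1) (e 0)) - y * y * (y ^ a * blockStep y a (e 1) (e 0))
    ≡⟨ step y (y ^ a) (ℤ.+ a) (e 1) (e 0) ⟩
  y ^ suc (suc a) * blockStep y (suc (suc a)) (e 1) (e 0) ∎
  where
  step : ∀ y Y A e₁ e₀ →
    ℤ.+ 2 * y * (y * Y * ((1ℤ + (1ℤ + A)) * e₁ - (1ℤ + A) * (y * e₀))) - y * y * (Y * ((1ℤ + A) * e₁ - A * (y * e₀)))
      ≡ y * (y * Y) * ((1ℤ + (1ℤ + (1ℤ + A))) * e₁ - (1ℤ + (1ℤ + A)) * (y * e₀))
  step = solve-∀

-- A block (p , a) stands for a + 1 consecutive copies of the label p.
unfoldBlocks : {L : Set} → List (L × ℕ) → List L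
unfoldBlocks []             = []
unfoldBlocks ((p , a) ∷ bs) = replicate (suc a) p ++ unfoldBlocks bs

blockPowers : {L : Set} → ℤ → List (L × ℕ) → ℤ
blockPowers y []             = 1ℤ
blockPowers y ((p , a) ∷ bs) = y ^ a * blockPowers y bs

expandBlocks : {L : Set} → ℤ → (List L → ℤ) → List L → List (L × ℕ) → ℤ
expandBlocks y f P []             = f P
expandBlocks y f P ((p , a) ∷ bs) = blockStep y a (expandBlocks y f (P ++ p ∷ []) bs) (expandBlocks y f P bs)

expandBlocks-cong : ∀ {L : Set} y {f g : List L → ℤ} → f ≗ g → ∀ P bs → expandBlocks y f P bs ≡ expandBlocks y g P bs
expandBlocks-cong y f≗g P []             = f≗g P
expandBlocks-cong y f≗g P ((p , a) ∷ bs) =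
  cong₂ (blockStep y a) (expandBlocks-cong y f≗g (P ++ p ∷ []) bs) (expandBlocks-cong y f≗g P bs)

module Labelled {L : Set} (τ : L → L → ℤ) (y : ℤ) where

  labelled : (ℓ : List L) → Matrix ℤ (length ℓ)
  labelled ℓ i j = τ (lookup ℓ i) (lookup ℓ j)

  labelMatrix : (ℓ : List L) → Matrix ℤ (length ℓ)
  labelMatrix ℓ i j = y * δ i j - labelled ℓ i j

  labelDet : List L → ℤ
  labelDet ℓ = detℤ (labelMatrix ℓ)

  private
    length-swap : ∀ (P : List L) x z R → length (P ++ x ∷ z ∷ R) ≡ length (P ++ z ∷ x ∷ R)
    length-swap []      x z R = refl
    length-swap (w ∷ P) x z R = cong suc (length-swap P x z R)

    2+length≤ : ∀ (P : List L) x z R → suc (suc (length P)) ℕ.≤ length (P ++ x ∷ z ∷ R)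
    2+length≤ []      x z R = s≤s (s≤s z≤n)
    2+length≤ (w ∷ P) x z R = s≤s (2+length≤ P x z R)

    lookup-swap : ∀ (P : List L) x z R (e : length (P ++ x ∷ z ∷ R) ≡ length (P ++ z ∷ x ∷ R)) i →
      lookup (P ++ z ∷ x ∷ R) (Fin.cast e i) ≡ lookup (P ++ x ∷ z ∷ R) (swapAt (length P) i)
    lookup-swap []      x z R e 0F            = refl
    lookup-swap []      x z R e 1F            = refl
    lookup-swap []      x z R e (suc (suc i)) = cong (lookup R) (FP.cast-is-id refl i)
    lookup-swap (w ∷ P) x z R e zero          = refl
    lookup-swap (w ∷ P) x z R e (suc i)       = lookup-swap P x z R (ℕP.suc-injective e) i

    lookup-toList : ∀ {n} (v : Vec L n) .(e : n ≡ length (Vec.toList v)) i →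
      lookup (Vec.toList v) (Fin.cast e i) ≡ Vec.lookup v i
    lookup-toList (x Vec.∷ v) e zero    = refl
    lookup-toList (x Vec.∷ v) e (suc i) = lookup-toList v (ℕP.suc-injective e) i

  labelDet-swap : ∀ (P : List L) x z R → labelDet (P ++ x ∷ z ∷ R) ≡ labelDet (P ++ z ∷ x ∷ R)
  labelDet-swap P x z R = begin
    labelDet (P ++ x ∷ z ∷ R)
      ≡⟨ sym (detℤ-swap (length P) (2+length≤ P x z R) (labelMatrix (P ++ x ∷ z ∷ R))) ⟩
    detℤ (λ i j → labelMatrix (P ++ x ∷ z ∷ R) (σ i) (σ j))
      ≡⟨ detℤ-cong (λ i j → cong₂ (λ d t → y * d - t)
           (trans (δ-injective σ (swapAt-injective (length P)) i j) (sym (δ-injective (Fin.cast e) (cast-injective e) i j)))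
           (sym (cong₂ τ (lookup-swap P x z R e i) (lookup-swap P x z R e j)))) ⟩
    detℤ (λ i j → labelMatrix (P ++ z ∷ x ∷ R) (Fin.cast e i) (Fin.cast e j))
      ≡⟨ detℤ-cast e (labelMatrix (P ++ z ∷ x ∷ R)) ⟩
    labelDet (P ++ z ∷ x ∷ R) ∎
    where
    σ : Fin (length (P ++ x ∷ z ∷ R)) → Fin (length (P ++ x ∷ z ∷ R))
    σ = swapAt (length P)
    e : length (P ++ x ∷ z ∷ R) ≡ length (P ++ z ∷ x ∷ R)
    e = length-swap P x z R

  labelDet-shift : ∀ (Q P : List L) x R → labelDet (Q ++ P ++ x ∷ R) ≡ labelDet (Q ++ x ∷ P ++ R)
  labelDet-shift Q []      x R = refl
  labelDet-shift Q (w ∷ P) x R = begin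
    labelDet (Q ++ w ∷ P ++ x ∷ R)         ≡⟨ cong labelDet (sym (LP.++-assoc Q (w ∷ []) (P ++ x ∷ R))) ⟩
    labelDet ((Q ++ w ∷ []) ++ P ++ x ∷ R) ≡⟨ labelDet-shift (Q ++ w ∷ []) P x R ⟩
    labelDet ((Q ++ w ∷ []) ++ x ∷ P ++ R) ≡⟨ cong labelDet (LP.++-assoc Q (w ∷ []) (x ∷ P ++ R)) ⟩
    labelDet (Q ++ w ∷ x ∷ P ++ R)         ≡⟨ labelDet-swap Q w x (P ++ R) ⟩
    labelDet (Q ++ x ∷ w ∷ P ++ R)         ∎

  labelDet-minor₀ : ∀ p R → columnsDet (labelMatrix (p ∷ p ∷ R) ∘ suc) suc ≡ labelDet (p ∷ R)
  labelDet-minor₀ p R = detℤ-cong λ r c → cong (λ d → y * d - labelled (p ∷ R) r c) (δ-suc r c)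

  -- Without column 1, the lower rows of the matrix of p ∷ p ∷ R are the matrix of p ∷ R
  -- with y removed from the corner.
  labelDet-minor₁ : ∀ p R →
    columnsDet (labelMatrix (p ∷ p ∷ R) ∘ suc) (punchIn 1F) ≡ labelDet (p ∷ R) + 1ℤ * (- y * labelDet R)
  labelDet-minor₁ p R = begin
    laplace (K′ 0F) (columnsDet (K′ ∘ suc))
      ≡⟨ laplace-cong {Ψ = columnsDet (K′ ∘ suc)} {Φ = columnsDet (K ∘ suc)} K′-row₀
                      (λ j → detℤ-cong λ r c → K′-below r (punchIn j c)) ⟩
    laplace (λ j → K 0F j + - y * δ 0F j) (columnsDet (K ∘ suc))
      ≡⟨ laplace-+δ (K 0F) (columnsDet (K ∘ suc)) (- y) 0F ⟩
    labelDet (p ∷ R) + 1ℤ * (- y * columnsDet (K ∘ suc) suc)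
      ≡⟨ cong (λ d → labelDet (p ∷ R) + 1ℤ * (- y * d))
              (detℤ-cong λ r c → cong (λ d → y * d - labelled R r c) (δ-suc r c)) ⟩
    labelDet (p ∷ R) + 1ℤ * (- y * labelDet R) ∎
    where
    K : Matrix ℤ (suc (length R))
    K = labelMatrix (p ∷ R)
    K′ : Matrix ℤ (suc (length R))
    K′ r c = labelMatrix (p ∷ p ∷ R) (suc r) (punchIn 1F c)
    K′-row₀ : ∀ j → K′ 0F j ≡ K 0F j + - y * δ 0F j
    K′-row₀ zero    = corner y (τ p p)
      where
      corner : ∀ y t → y * 0ℤ - t ≡ (y * 1ℤ - t) + - y * 1ℤ
      corner = solve-∀
    K′-row₀ (suc j) = trans (cong (λ d → y * d - labelled (p ∷ R) 0F (suc j)) (δ-suc 0F (suc j)))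
                            (pad y (labelled (p ∷ R) 0F (suc j)))
      where
      pad : ∀ y t → y * 0ℤ - t ≡ (y * 0ℤ - t) + - y * 0ℤ
      pad = solve-∀
    K′-below : ∀ r c → K′ (suc r) c ≡ K (suc r) c
    K′-below r zero    = refl
    K′-below r (suc c) = cong (λ d → y * d - labelled (p ∷ R) (suc r) (suc c)) (δ-suc (suc r) (suc c))

  -- Rows 0 and 1 differ by y (e₀ - e₁): replacing row 0 by row 1 leaves two equal rows, and the
  -- difference is expanded along row 0.
  labelDet-double : ∀ p R → labelDet (p ∷ p ∷ R) ≡ ℤ.+ 2 * y * labelDet (p ∷ R) - y * y * labelDet R
  labelDet-double p R = begin
    laplace (M 0F) Ψ
      ≡⟨ laplace-cong {Ψ = Ψ} {Φ = Ψ} row₀ (λ _ → refl) ⟩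
    laplace (λ j → (M 1F j + - y * δ 1F j) + y * δ 0F j) Ψ
      ≡⟨ laplace-+δ (λ j → M 1F j + - y * δ 1F j) Ψ y 0F ⟩
    laplace (λ j → M 1F j + - y * δ 1F j) Ψ + 1ℤ * (y * Ψ suc)
      ≡⟨ cong₂ _+_ (laplace-+δ (M 1F) Ψ (- y) 1F) (cong (λ d → 1ℤ * (y * d)) (labelDet-minor₀ p R)) ⟩
    (laplace (M 1F) Ψ + -1ℤ * (- y * Ψ (punchIn 1F))) + 1ℤ * (y * labelDet (p ∷ R))
      ≡⟨ cong₂ (λ a b → (a + -1ℤ * (- y * b)) + 1ℤ * (y * labelDet (p ∷ R)))
               (detℤ-equalRows (M 1F V.∷ (M ∘ suc)) (λ _ → refl)) (labelDet-minor₁ p R) ⟩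
    (0ℤ + -1ℤ * (- y * (labelDet (p ∷ R) + 1ℤ * (- y * labelDet R)))) + 1ℤ * (y * labelDet (p ∷ R))
      ≡⟨ collect y (labelDet (p ∷ R)) (labelDet R) ⟩
    ℤ.+ 2 * y * labelDet (p ∷ R) - y * y * labelDet R ∎
    where
    M : Matrix ℤ (suc (suc (length R)))
    M = labelMatrix (p ∷ p ∷ R)
    Ψ : (Fin (suc (length R)) → Fin (suc (suc (length R)))) → ℤ
    Ψ = columnsDet (M ∘ suc)
    row₀ : ∀ j → M 0F j ≡ (M 1F j + - y * δ 1F j) + y * δ 0F j
    row₀ j = shift y (δ 0F j) (δ 1F j) (labelled (p ∷ p ∷ R) 0F j)
      where
      shift : ∀ y d₀ d₁ t → y * d₀ - t ≡ ((y * d₁ - t) + - y * d₁) + y * d₀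
      shift = solve-∀
    collect : ∀ y a b → (0ℤ + -1ℤ * (- y * (a + 1ℤ * (- y * b)))) + 1ℤ * (y * a) ≡ ℤ.+ 2 * y * a - y * y * b
    collect = solve-∀

  labelDet-doubleAt : ∀ (P : List L) p R →
    labelDet (P ++ p ∷ p ∷ R) ≡ ℤ.+ 2 * y * labelDet (P ++ p ∷ R) - y * y * labelDet (P ++ R)
  labelDet-doubleAt P p R = begin
    labelDet (P ++ p ∷ p ∷ R)   ≡⟨ labelDet-shift [] P p (p ∷ R) ⟩
    labelDet (p ∷ P ++ p ∷ R)   ≡⟨ labelDet-shift (p ∷ []) P p R ⟩
    labelDet (p ∷ p ∷ P ++ R)   ≡⟨ labelDet-double p (P ++ R) ⟩
    ℤ.+ 2 * y * labelDet (p ∷ P ++ R) - y * y * labelDet (P ++ R)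
      ≡⟨ cong (λ d → ℤ.+ 2 * y * d - y * y * labelDet (P ++ R)) (sym (labelDet-shift [] P p R)) ⟩
    ℤ.+ 2 * y * labelDet (P ++ p ∷ R) - y * y * labelDet (P ++ R) ∎

  labelDet-block : ∀ (P : List L) p R a →
    labelDet (P ++ replicate (suc a) p ++ R) ≡ y ^ a * blockStep y a (labelDet (P ++ p ∷ R)) (labelDet (P ++ R))
  labelDet-block P p R = doubleRoot-recurrence y (λ k → labelDet (P ++ replicate k p ++ R))
                                                 (λ k → labelDet-doubleAt P p (replicate k p ++ R))

  labelDet-blocks : ∀ (P : List L) bs → labelDet (P ++ unfoldBlocks bs) ≡ blockPowers y bs * expandBlocks y labelDet P bs
  labelDet-blocks P [] = trans (cong labelDet (LP.++-identityʳ P)) (sym (ℤP.*-identityˡ (labelDet P)))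
  labelDet-blocks P ((p , a) ∷ bs) = begin
    labelDet (P ++ replicate (suc a) p ++ unfoldBlocks bs)
      ≡⟨ labelDet-block P p (unfoldBlocks bs) a ⟩
    y ^ a * blockStep y a (labelDet (P ++ p ∷ unfoldBlocks bs)) (labelDet (P ++ unfoldBlocks bs))
      ≡⟨ cong₂ (λ u v → y ^ a * blockStep y a u v)
               (trans (cong labelDet (sym (LP.++-assoc P (p ∷ []) (unfoldBlocks bs)))) (labelDet-blocks (P ++ p ∷ []) bs))
               (labelDet-blocks P bs) ⟩
    y ^ a * blockStep y a (blockPowers y bs * expandBlocks y labelDet (P ++ p ∷ []) bs)
                          (blockPowers y bs * expandBlocks y labelDet P bs)
      ≡⟨ factor (y ^ a) (blockPowers y bs) (ℤ.+ a) y _ _ ⟩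
    (y ^ a * blockPowers y bs) * expandBlocks y labelDet P ((p , a) ∷ bs) ∎
    where
    factor : ∀ Y Z A y e₁ e₀ → Y * ((1ℤ + A) * (Z * e₁) - A * (y * (Z * e₀))) ≡ (Y * Z) * ((1ℤ + A) * e₁ - A * (y * e₀))
    factor = solve-∀

  labelDet-unfoldBlocks : ∀ bs → labelDet (unfoldBlocks bs) ≡ blockPowers y bs * expandBlocks y labelDet [] bs
  labelDet-unfoldBlocks = labelDet-blocks []

  labelDet-fromVec : ∀ {n} (v : Vec L n) →
    detℤ (λ i j → y * δ i j - τ (Vec.lookup v i) (Vec.lookup v j)) ≡ labelDet (Vec.toList v)
  labelDet-fromVec {n} v = begin
    detℤ (λ i j → y * δ i j - τ (Vec.lookup v i) (Vec.lookup v j))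
      ≡⟨ detℤ-cong (λ i j → cong₂ (λ d t → y * d - t) (sym (δ-injective (Fin.cast e) (cast-injective e) i j))
                                                      (sym (cong₂ τ (lookup-toList v e i) (lookup-toList v e j)))) ⟩
    detℤ (λ i j → labelMatrix (Vec.toList v) (Fin.cast e i) (Fin.cast e j))
      ≡⟨ detℤ-cast e (labelMatrix (Vec.toList v)) ⟩
    labelDet (Vec.toList v) ∎
    where
    e : n ≡ length (Vec.toList v)
    e = sym (VP.length-toList v)

  charPolyAt : List L → ℤ
  charPolyAt ℓ = evalP (charPoly (labelled ℓ)) y

  labelDet≗charPolyAt : labelDet ≗ charPolyAt
  labelDet≗charPolyAt ℓ = sym (evalP-charPoly (labelled ℓ) y)

open Labelled

-- Chain graphs with runs

Sorted : ∀ {k n} → Vec (Fin k) n → Set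
Sorted = AllPairs Fin._≤_

sorted-monotone : ∀ {k n} {v : Vec (Fin k) n} → Sorted v → ∀ {i j} → i Fin.≤ j → Vec.lookup v i Fin.≤ Vec.lookup v j
sorted-monotone (_ ∷ _)      {zero}  {zero}  _         = ℕP.≤-refl
sorted-monotone (v₀≤ ∷ _)    {zero}  {suc j} _         = AllP.lookup⁺ v₀≤ j
sorted-monotone (_ ∷ sorted) {suc i} {suc j} (s≤s i≤j) = sorted-monotone sorted i≤j

sorted-<ᵇ : ∀ {k n} {v : Vec (Fin k) n} → Sorted v → ∀ {i j} → Vec.lookup v i ≢ Vec.lookup v j →
  (toℕ i ℕ.<ᵇ toℕ j) ≡ (toℕ (Vec.lookup v i) ℕ.<ᵇ toℕ (Vec.lookup v j))
sorted-<ᵇ {v = v} sorted {i} {j} vi≢vj = Reflects.det (ℕP.<ᵇ-reflects-< (toℕ i) (toℕ j))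
  (Reflects.fromEquivalence (from ∘ ℕP.<ᵇ⇒< _ _) (ℕP.<⇒<ᵇ ∘ to))
  where
  to : i Fin.< j → Vec.lookup v i Fin.< Vec.lookup v j
  to i<j = ℕP.≤∧≢⇒< (sorted-monotone sorted (ℕP.<⇒≤ i<j)) (vi≢vj ∘ FP.toℕ-injective)
  from : Vec.lookup v i Fin.< Vec.lookup v j → i Fin.< j
  from vi<vj = ℕP.≰⇒> λ j≤i → ℕP.<⇒≱ vi<vj (sorted-monotone sorted j≤i)

-- Position i of the string lies in a run of the symbol at position v i of bits.
chainAdjB-runs : ∀ {k n} (bits : Vec Bool k) (v : Vec (Fin k) n) → Sorted v → ∀ i j →
  chainAdjB (Vec.map (Vec.lookup bits) v) i j ≡ chainAdjB bits (Vec.lookup v i) (Vec.lookup v j)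
chainAdjB-runs bits v sorted i j
  rewrite VP.lookup-map i (Vec.lookup bits) v | VP.lookup-map j (Vec.lookup bits) v
  with Vec.lookup v i FP.≟ Vec.lookup v j
... | yes vi≡vj rewrite vi≡vj =
  trans (noLoop (toℕ i ℕ.<ᵇ toℕ j) (toℕ j ℕ.<ᵇ toℕ i) b) (sym (noLoop (p ℕ.<ᵇ p) (p ℕ.<ᵇ p) b))
  where
  p : ℕ
  p = toℕ (Vec.lookup v j)
  b : Bool
  b = Vec.lookup bits (Vec.lookup v j)
  noLoop : ∀ x z b → (x ∧ not b ∧ b) ∨ (z ∧ not b ∧ b) ≡ false
  noLoop x z b = cong₂ _∨_ (trans (cong (x ∧_) (BP.∧-inverseˡ b)) (BP.∧-zeroʳ x))
                           (trans (cong (z ∧_) (BP.∧-inverseˡ b)) (BP.∧-zeroʳ z))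
... | no vi≢vj = cong₂ (λ u w → (u ∧ not (Vec.lookup bits (Vec.lookup v i)) ∧ Vec.lookup bits (Vec.lookup v j))
                              ∨ (w ∧ not (Vec.lookup bits (Vec.lookup v j)) ∧ Vec.lookup bits (Vec.lookup v i)))
                       (sorted-<ᵇ sorted vi≢vj) (sorted-<ᵇ sorted (vi≢vj ∘ sym))

private
  all-replicate : ∀ {k} {q p : Fin k} a → q Fin.≤ p → All (q Fin.≤_) (Vec.replicate a p)
  all-replicate zero    q≤p = All.[]
  all-replicate (suc a) q≤p = q≤p All.∷ all-replicate a q≤p

sorted-replicate : ∀ {k} (p : Fin k) a → Sorted (Vec.replicate a p)
sorted-replicate p zero    = AllPairs.[]
sorted-replicate p (suc a) = all-replicate a ℕP.≤-refl ∷ sorted-replicate p a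

sorted-replicate-++ : ∀ {k n} {v : Vec (Fin k) n} (p : Fin k) a →
  All (p Fin.≤_) v → Sorted v → Sorted (Vec.replicate a p Vec.++ v)
sorted-replicate-++ p zero    _     sorted = sorted
sorted-replicate-++ p (suc a) p≤all sorted = AllP.++⁺ (all-replicate a ℕP.≤-refl) p≤all ∷ sorted-replicate-++ p a p≤all sorted

-- Its runs, read as the string 0101; their chain graph is the path 1F 0F 3F 2F.
runBits : Vec Bool 4
runBits = false Vec.∷ true Vec.∷ false Vec.∷ true Vec.∷ Vec.[]

runLabels : (s : ℕ) → Vec (Fin 4) (s ℕ.+ (2 ℕ.* s ℕ.+ (2 ℕ.* s ℕ.+ s)))
runLabels s = Vec.replicate s 0F Vec.++ Vec.replicate (2 ℕ.* s) 1F Vec.++ Vec.replicate (2 ℕ.* s) 2F Vec.++ Vec.replicate s 3F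

string5-runs : ∀ s → string5 s ≡ Vec.map (Vec.lookup runBits) (runLabels s)
string5-runs s = sym (begin
  Vec.map f (R₀ Vec.++ R₁ Vec.++ R₂ Vec.++ R₃)
    ≡⟨ VP.map-++ f R₀ (R₁ Vec.++ R₂ Vec.++ R₃) ⟩
  Vec.map f R₀ Vec.++ Vec.map f (R₁ Vec.++ R₂ Vec.++ R₃)
    ≡⟨ cong (Vec.map f R₀ Vec.++_) (VP.map-++ f R₁ (R₂ Vec.++ R₃)) ⟩
  Vec.map f R₀ Vec.++ Vec.map f R₁ Vec.++ Vec.map f (R₂ Vec.++ R₃)
    ≡⟨ cong (λ w → Vec.map f R₀ Vec.++ Vec.map f R₁ Vec.++ w) (VP.map-++ f R₂ R₃) ⟩
  Vec.map f R₀ Vec.++ Vec.map f R₁ Vec.++ Vec.map f R₂ Vec.++ Vec.map f R₃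
    ≡⟨ cong₂ Vec._++_ (VP.map-replicate f 0F s) (cong₂ Vec._++_ (VP.map-replicate f 1F (2 ℕ.* s))
         (cong₂ Vec._++_ (VP.map-replicate f 2F (2 ℕ.* s)) (VP.map-replicate f 3F s))) ⟩
  string5 s ∎)
  where
  f : Fin 4 → Bool
  f = Vec.lookup runBits
  R₀ R₃ : Vec (Fin 4) s
  R₀ = Vec.replicate s 0F
  R₃ = Vec.replicate s 3F
  R₁ R₂ : Vec (Fin 4) (2 ℕ.* s)
  R₁ = Vec.replicate (2 ℕ.* s) 1F
  R₂ = Vec.replicate (2 ℕ.* s) 2F

runLabels-sorted : ∀ s → Sorted (runLabels s)
runLabels-sorted s =
  sorted-replicate-++ 0F s (AllP.++⁺ (all-replicate (2 ℕ.* s) z≤n) (AllP.++⁺ (all-replicate (2 ℕ.* s) z≤n) (all-replicate s z≤n)))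
    (sorted-replicate-++ 1F (2 ℕ.* s) (AllP.++⁺ (all-replicate (2 ℕ.* s) (s≤s z≤n)) (all-replicate s (s≤s z≤n)))
      (sorted-replicate-++ 2F (2 ℕ.* s) (all-replicate s (s≤s (s≤s z≤n)))
        (sorted-replicate 3F s)))

runτ : Fin 4 → Fin 4 → ℤ
runτ p q = 1ℤ - (chainAdj runBits p q + chainAdj runBits p q)

runBlocks : ℕ → List (Fin 4 × ℕ)
runBlocks s′ = (0F , s′) ∷ (1F , s′ ℕ.+ suc s′) ∷ (2F , s′ ℕ.+ suc s′) ∷ (3F , s′) ∷ []

toList-runLabels : ∀ s′ → Vec.toList (runLabels (suc s′)) ≡ unfoldBlocks (runBlocks s′)
toList-runLabels s′ = begin
  Vec.toList (R₀ Vec.++ R₁ Vec.++ R₂ Vec.++ R₃)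
    ≡⟨ VP.toList-++ R₀ (R₁ Vec.++ R₂ Vec.++ R₃) ⟩
  Vec.toList R₀ ++ Vec.toList (R₁ Vec.++ R₂ Vec.++ R₃)
    ≡⟨ cong (Vec.toList R₀ ++_) (VP.toList-++ R₁ (R₂ Vec.++ R₃)) ⟩
  Vec.toList R₀ ++ Vec.toList R₁ ++ Vec.toList (R₂ Vec.++ R₃)
    ≡⟨ cong (λ w → Vec.toList R₀ ++ Vec.toList R₁ ++ w) (VP.toList-++ R₂ R₃) ⟩
  Vec.toList R₀ ++ Vec.toList R₁ ++ Vec.toList R₂ ++ Vec.toList R₃
    ≡⟨ cong₂ _++_ (VP.toList-replicate (suc s′) 0F) (cong₂ _++_ (VP.toList-replicate (2 ℕ.* suc s′) 1F)
         (cong₂ _++_ (VP.toList-replicate (2 ℕ.* suc s′) 2F)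
                     (trans (VP.toList-replicate (suc s′) 3F) (sym (LP.++-identityʳ (replicate (suc s′) 3F)))))) ⟩
  replicate (suc s′) 0F ++ replicate (2 ℕ.* suc s′) 1F ++ replicate (2 ℕ.* suc s′) 2F ++ replicate (suc s′) 3F ++ []
    ≡⟨ cong (λ m → replicate (suc s′) 0F ++ replicate m 1F ++ replicate m 2F ++ replicate (suc s′) 3F ++ []) twice ⟩
  unfoldBlocks (runBlocks s′) ∎
  where
  R₀ R₃ : Vec (Fin 4) (suc s′)
  R₀ = Vec.replicate (suc s′) 0F
  R₃ = Vec.replicate (suc s′) 3F
  R₁ R₂ : Vec (Fin 4) (2 ℕ.* suc s′)
  R₁ = Vec.replicate (2 ℕ.* suc s′) 1F
  R₂ = Vec.replicate (2 ℕ.* suc s′) 2F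
  twice : 2 ℕ.* suc s′ ≡ suc (s′ ℕ.+ suc s′)
  twice = cong (λ k → suc (s′ ℕ.+ suc k)) (ℕP.+-identityʳ s′)

runQuotient : ℕ → ℤ → ℤ
runQuotient s′ y = (y + ℤ.+ 2 * ℤ.+ suc s′) * (y - ℤ.+ 4 * ℤ.+ suc s′) * (y - ℤ.+ 4 * ℤ.+ suc s′) * y

-- The characteristic polynomial of the 4 × 4 quotient matrix of the runs, as expandBlocks computes
-- it over runBlocks.  The leaves are the characteristic polynomials of the label subsets (d₃ for
-- 0F 1F 2F and 1F 2F 3F, d₃′ for 0F 1F 3F and 0F 2F 3F) in the Horner form that evalP produces,
-- so that expandBlocks-runs holds by computation.
runQuotient-factors : ∀ y a →
  let b = a + (1ℤ + a)
      s = 1ℤ + a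
      step : ℤ → ℤ → ℤ → ℤ
      step w e₁ e₀ = (1ℤ + w) * e₁ - w * (y * e₀)
      d₀  = 1ℤ + y * 0ℤ
      d₁  = - 1ℤ + y * (1ℤ + y * 0ℤ)
      d₂  = 0ℤ + y * (- ℤ.+ 2 + y * (1ℤ + y * 0ℤ))
      d₃  = ℤ.+ 4 + y * (0ℤ + y * (- ℤ.+ 3 + y * (1ℤ + y * 0ℤ)))
      d₃′ = 0ℤ + y * (0ℤ + y * (- ℤ.+ 3 + y * (1ℤ + y * 0ℤ)))
      d₄  = 0ℤ + y * (ℤ.+ 8 + y * (0ℤ + y * (- ℤ.+ 4 + y * (1ℤ + y * 0ℤ))))
  in step a (step b (step b (step a d₄ d₃) (step a d₃′ d₂)) (step b (step a d₃′ d₂) (step a d₂ d₁)))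
            (step b (step b (step a d₃ d₂) (step a d₂ d₁)) (step b (step a d₂ d₁) (step a d₁ d₀)))
     ≡ (y + ℤ.+ 2 * s) * (y - ℤ.+ 4 * s) * (y - ℤ.+ 4 * s) * y
runQuotient-factors = solve-∀

expandBlocks-runs : ∀ s′ y → expandBlocks y (charPolyAt runτ y) [] (runBlocks s′) ≡ runQuotient s′ y
expandBlocks-runs s′ y = runQuotient-factors y (ℤ.+ s′)

labelDet-runs : ∀ s′ y → labelDet runτ y (Vec.toList (runLabels (suc s′)))
  ≡ blockPowers y (runBlocks s′) * runQuotient s′ y
labelDet-runs s′ y = begin
  labelDet runτ y (Vec.toList (runLabels (suc s′)))
    ≡⟨ cong (labelDet runτ y) (toList-runLabels s′) ⟩
  labelDet runτ y (unfoldBlocks (runBlocks s′))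
    ≡⟨ labelDet-unfoldBlocks runτ y (runBlocks s′) ⟩
  blockPowers y (runBlocks s′) * expandBlocks y (labelDet runτ y) [] (runBlocks s′)
    ≡⟨ cong (blockPowers y (runBlocks s′) *_) (trans
         -- f and g are given: inferring them would make Agda unfold the expansion.
         (expandBlocks-cong y {f = labelDet runτ y} {g = charPolyAt runτ y} (labelDet≗charPolyAt runτ y) [] (runBlocks s′))
         (expandBlocks-runs s′ y)) ⟩
  blockPowers y (runBlocks s′) * runQuotient s′ y ∎

μ₋ μ₊ : ℕ → ℤ
μ₋ s = - (1ℤ + ℤ.+ 2 * ℤ.+ s)
μ₊ s = ℤ.+ 4 * ℤ.+ s - 1ℤ

runSpectrum : ℤ → (n : ℕ) → Vec ℤ (suc n)
runSpectrum μ n = μ Vec.∷ Vec.replicate n -1ℤ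

spectrum : (s′ : ℕ) → Vec ℤ (suc s′ ℕ.+ (2 ℕ.* suc s′ ℕ.+ (2 ℕ.* suc s′ ℕ.+ suc s′)))
spectrum s′ = runSpectrum (μ₋ (suc s′)) s′ Vec.++ runSpectrum (μ₊ (suc s′)) (ℕ.pred (2 ℕ.* suc s′))
       Vec.++ runSpectrum (μ₊ (suc s′)) (ℕ.pred (2 ℕ.* suc s′)) Vec.++ runSpectrum -1ℤ s′

linearProduct-++ : ∀ {m n} t (u : Vec ℤ m) (w : Vec ℤ n) → linearProduct t (u Vec.++ w) ≡ linearProduct t u * linearProduct t w
linearProduct-++ t Vec.[]      w = sym (ℤP.*-identityˡ (linearProduct t w))
linearProduct-++ t (l Vec.∷ u) w =
  trans (cong ((t - l) *_) (linearProduct-++ t u w)) (sym (ℤP.*-assoc (t - l) (linearProduct t u) (linearProduct t w)))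

linearProduct-runSpectrum : ∀ t μ n → linearProduct t (runSpectrum μ n) ≡ (t - μ) * (t + 1ℤ) ^ n
linearProduct-runSpectrum t μ n = cong ((t - μ) *_) (replicate-1 n)
  where
  replicate-1 : ∀ n → linearProduct t (Vec.replicate n -1ℤ) ≡ (t + 1ℤ) ^ n
  replicate-1 zero    = refl
  replicate-1 (suc n) = cong ((t + 1ℤ) *_) (replicate-1 n)
linearProduct-spectrum : ∀ s′ t → linearProduct t (spectrum s′)
  ≡ ((t - μ₋ (suc s′)) * (t + 1ℤ) ^ s′) * (((t - μ₊ (suc s′)) * (t + 1ℤ) ^ (s′ ℕ.+ suc s′))
      * (((t - μ₊ (suc s′)) * (t + 1ℤ) ^ (s′ ℕ.+ suc s′)) * ((t - -1ℤ) * (t + 1ℤ) ^ s′)))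
linearProduct-spectrum s′ t = begin
  linearProduct t (R₋ Vec.++ R₊ Vec.++ R₊ Vec.++ R₁)
    ≡⟨ linearProduct-++ t R₋ (R₊ Vec.++ R₊ Vec.++ R₁) ⟩
  linearProduct t R₋ * linearProduct t (R₊ Vec.++ R₊ Vec.++ R₁)
    ≡⟨ cong (linearProduct t R₋ *_) (linearProduct-++ t R₊ (R₊ Vec.++ R₁)) ⟩
  linearProduct t R₋ * (linearProduct t R₊ * linearProduct t (R₊ Vec.++ R₁))
    ≡⟨ cong (λ r → linearProduct t R₋ * (linearProduct t R₊ * r)) (linearProduct-++ t R₊ R₁) ⟩
  linearProduct t R₋ * (linearProduct t R₊ * (linearProduct t R₊ * linearProduct t R₁))
    ≡⟨ cong₂ (λ a b → a * (b * (b * linearProduct t R₁))) (linearProduct-runSpectrum t (μ₋ (suc s′)) s′) R₊-product ⟩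
  ((t - μ₋ (suc s′)) * (t + 1ℤ) ^ s′) * (((t - μ₊ (suc s′)) * (t + 1ℤ) ^ (s′ ℕ.+ suc s′))
      * (((t - μ₊ (suc s′)) * (t + 1ℤ) ^ (s′ ℕ.+ suc s′)) * linearProduct t R₁))
    ≡⟨ cong (λ r → ((t - μ₋ (suc s′)) * (t + 1ℤ) ^ s′) * (((t - μ₊ (suc s′)) * (t + 1ℤ) ^ (s′ ℕ.+ suc s′))
                      * (((t - μ₊ (suc s′)) * (t + 1ℤ) ^ (s′ ℕ.+ suc s′)) * r)))
            (linearProduct-runSpectrum t -1ℤ s′) ⟩
  ((t - μ₋ (suc s′)) * (t + 1ℤ) ^ s′) * (((t - μ₊ (suc s′)) * (t + 1ℤ) ^ (s′ ℕ.+ suc s′))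
      * (((t - μ₊ (suc s′)) * (t + 1ℤ) ^ (s′ ℕ.+ suc s′)) * ((t - -1ℤ) * (t + 1ℤ) ^ s′))) ∎
  where
  R₋ R₁ : Vec ℤ (suc s′)
  R₋ = runSpectrum (μ₋ (suc s′)) s′
  R₁ = runSpectrum -1ℤ s′
  R₊ : Vec ℤ (2 ℕ.* suc s′)
  R₊ = runSpectrum (μ₊ (suc s′)) (ℕ.pred (2 ℕ.* suc s′))
  R₊-product : linearProduct t R₊ ≡ (t - μ₊ (suc s′)) * (t + 1ℤ) ^ (s′ ℕ.+ suc s′)
  R₊-product = trans (linearProduct-runSpectrum t (μ₊ (suc s′)) (ℕ.pred (2 ℕ.* suc s′)))
                     (cong (λ k → (t - μ₊ (suc s′)) * (t + 1ℤ) ^ (s′ ℕ.+ suc k)) (ℕP.+-identityʳ s′))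

spectrum-product : ∀ s′ t → blockPowers (t + 1ℤ) (runBlocks s′) * runQuotient s′ (t + 1ℤ) ≡ linearProduct t (spectrum s′)
spectrum-product s′ t =
  trans (regroup t (ℤ.+ suc s′) ((t + 1ℤ) ^ s′) ((t + 1ℤ) ^ (s′ ℕ.+ suc s′))) (sym (linearProduct-spectrum s′ t))
  where
  regroup : ∀ t s Y Z →
    Y * (Z * (Z * (Y * 1ℤ))) * ((t + 1ℤ + ℤ.+ 2 * s) * (t + 1ℤ - ℤ.+ 4 * s) * (t + 1ℤ - ℤ.+ 4 * s) * (t + 1ℤ))
      ≡ ((t - - (1ℤ + ℤ.+ 2 * s)) * Y) * (((t - (ℤ.+ 4 * s - 1ℤ)) * Z) * (((t - (ℤ.+ 4 * s - 1ℤ)) * Z) * ((t - -1ℤ) * Y)))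
  regroup = solve-∀

charPoly-string5 : ∀ s′ t → evalP (charPoly (seidel (chainAdj (string5 (suc s′))))) t ≡ linearProduct t (spectrum s′)
charPoly-string5 s′ t = begin
  evalP (charPoly (seidel (chainAdj (string5 (suc s′))))) t
    ≡⟨ evalP-charPoly (seidel (chainAdj (string5 (suc s′)))) t ⟩
  detℤ (λ i j → t * δ i j - seidel (chainAdj (string5 (suc s′))) i j)
    ≡⟨ detℤ-cong entry ⟩
  detℤ (λ i j → (t + 1ℤ) * δ i j - runτ (Vec.lookup (runLabels (suc s′)) i) (Vec.lookup (runLabels (suc s′)) j))
    ≡⟨ labelDet-fromVec runτ (t + 1ℤ) (runLabels (suc s′)) ⟩
  labelDet runτ (t + 1ℤ) (Vec.toList (runLabels (suc s′)))
    ≡⟨ labelDet-runs s′ (t + 1ℤ) ⟩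
  blockPowers (t + 1ℤ) (runBlocks s′) * runQuotient s′ (t + 1ℤ)
    ≡⟨ spectrum-product s′ t ⟩
  linearProduct t (spectrum s′) ∎
  where
  entry : ∀ i j → t * δ i j - seidel (chainAdj (string5 (suc s′))) i j
                ≡ (t + 1ℤ) * δ i j - runτ (Vec.lookup (runLabels (suc s′)) i) (Vec.lookup (runLabels (suc s′)) j)
  entry i j = trans (shift t (δ i j) (chainAdj (string5 (suc s′)) i j))
    (cong (λ a → (t + 1ℤ) * δ i j - (1ℤ - (a + a))) (cong (λ b → if b then 1ℤ else 0ℤ)
      (trans (cong (λ w → chainAdjB w i j) (string5-runs (suc s′)))
             (chainAdjB-runs runBits (runLabels (suc s′)) (runLabels-sorted (suc s′)) i j))))
    where
    shift : ∀ t d a → t * d - (1ℤ - d - (a + a)) ≡ (t + 1ℤ) * d - (1ℤ - (a + a))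
    shift = solve-∀

mainTheorem5 : (s : ℕ) → 0 < s → SeidelIntegral (chainAdj (string5 s))
mainTheorem5 (suc s′) _ = spectrum s′ , ≈P-fromEval (charPoly (seidel (chainAdj (string5 (suc s′)))))
  (prodP (Vec.map (λ l → X +P constP (- l)) (spectrum s′)))
  (λ k → trans (charPoly-string5 s′ (ℤ.+ suc k)) (sym (evalP-linearFactors (spectrum s′) (ℤ.+ suc k))))
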